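{- Let $k$ be an integer and $l>0$ an integer. Then there are only finitely many pairs of primes $p,q$ such that $lpq \in C_k$, $l\neq k$, $lp\neq k$, and $lq \neq k$.
   Context: For an integer $k$, $C_k$ denotes the set of integers $n>\max(k,0)$ such that $a^{n-k+1}\equiv a \pmod{n}$ for all integers $a$. -}

module Defs where

open import Data.Nat using (ℕ; suc)
open import Data.Integer using (ℤ; +_; _-_; _^_; _<_; ∣_∣)
open import Data.Integer.Divisibility using (_∣_)
open import Data.Product using (_×_)

-- Since n > k, the exponent n - k + 1 is a natural number ≥ 2; we write it
-- as ∣ n - k ∣ + 1, which equals n - k + 1 whenever n > k.
InC : ℤ → ℕ → Set
InC k n = (k < + n) × (+ 0 < + n) ×
          ((a : ℤ) → (+ n) ∣ (a ^ suc ∣ + n - k ∣ - a))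

-- Put n = lpq ∈ C_k and m = n − k, so that a^(m+1) ≡ a (mod r) for every prime r ∣ n and every a.
-- Then every unit modulo r is an m-th root of unity, which forces r − 1 ∣ m: the exponents e with
-- a^e ≡ 1 for all units are closed under sums and differences and contain r − 1 (Fermat), but no e
-- with 0 < e < r − 1, as r would then divide the e-th finite difference of y^e − 1 at 1, …, e + 1,
-- which is e!. Hence q − 1 ∣ lp − k and p − 1 ∣ lq − k. For p ≤ q write lp − k = t(q − 1); then
-- |t| ≤ 2l + |k|, and p − 1 divides (l − k)(l + t) = t(lq − k) − l²(p − 1) + l(lp − k − t(q − 1)).
-- Unless t = −l this product is nonzero and bounds p, after which |lp − k| ≥ q − 1 bounds q; if
-- t = −l, then k = l(p + q − 1) bounds both.
module Submission where

open import Data.Fin as Fin using (Fin; toℕ; fromℕ; inject₁)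
import Data.Fin.Properties as Finₚ
open import Data.Integer as ℤ using (ℤ; +_; _+_; _*_; _-_; _^_; 0ℤ; 1ℤ)
import Data.Integer.Properties as ℤₚ
open import Data.Integer.Divisibility.Signed
  using (_∣_; divides; ∣ᵤ⇒∣; ∣⇒∣ᵤ; ∣-refl; ∣-trans; ∣m∣n⇒∣m+n; ∣m∣n⇒∣m-n; ∣m⇒∣m*n; ∣n⇒∣m*n)
open import Data.Integer.Tactic.RingSolver using (solve-∀)
open import Data.Nat as ℕ using (ℕ; zero; suc; _!; z≤n; s≤s; _∸_; NonZero)
import Data.Nat.Properties as ℕₚ
import Data.Nat.Divisibility as ℕᵈ
open import Data.Nat.Combinatorics using (_C_; k![n∸k]!∣n!; nCn≡1)
open import Data.Nat.Combinatorics.Specification using (nCk≡n!/k![n-k]!)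
open import Data.Nat.DivMod using (_%_; _/_; m/n*n≡m; m≡m%n+[m/n]*n; m%n<n)
open import Data.Nat.Primality using (Prime; euclidsLemma; prime⇒nonTrivial)
open import Data.Product using (∃; _×_; _,_; swap)
open import Data.Sum using (_⊎_; inj₁; inj₂; [_,_]′)
open import Function using (_∘_)
import Data.Nat.Tactic.RingSolver as ℕ-Solver
open import Relation.Nullary using (¬_; contradiction; yes; no)
open import Relation.Binary.PropositionalEquality
  using (_≡_; _≢_; refl; sym; trans; cong; cong₂; subst; module ≡-Reasoning)
import Algebra.Properties.CommutativeSemiring.Binomial ℤₚ.+-*-commutativeSemiring as Binomial
import Algebra.Properties.Semiring.Sum ℤₚ.+-*-semiring as Sum
import Algebra.Definitions.RawSemiring ℤ.+-*-rawSemiring as Raw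

open import Defs

private variable
  a e g l m n p q P Q : ℕ
  x y K t : ℤ

prime⇒2≤ : Prime p → 2 ℕ.≤ p
prime⇒2≤ {p} pr = ℕ.nonTrivial⇒n>1 p {{prime⇒nonTrivial pr}}

p∣n!⇒p≤n : Prime p → p ℕᵈ.∣ n ! → p ℕ.≤ n
p∣n!⇒p≤n {n = zero} pr p∣1 = contradiction (ℕᵈ.∣1⇒≡1 p∣1) (ℕ.nonTrivial⇒≢1 {{prime⇒nonTrivial pr}})
p∣n!⇒p≤n {n = suc n} pr p∣n! with euclidsLemma (suc n) (n !) pr p∣n!
... | inj₁ p∣1+n = ℕᵈ.∣⇒≤ p∣1+n
... | inj₂ p∣n!′ = ℕₚ.m≤n⇒m≤1+n (p∣n!⇒p≤n pr p∣n!′)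

nCm*m!*[n∸m]!≡n! : m ℕ.≤ n → (n C m) ℕ.* (m ! ℕ.* (n ∸ m) !) ≡ n !
nCm*m!*[n∸m]!≡n! {m} {n} m≤n =
  trans (cong (ℕ._* (m ! ℕ.* (n ∸ m) !)) (nCk≡n!/k![n-k]! m≤n))
        (m/n*n≡m {{ℕₚ._!*_!≢0 m (n ∸ m)}} (k![n∸k]!∣n! m≤n))

prime∣pCk : Prime p → 0 ℕ.< m → m ℕ.< p → p ℕᵈ.∣ p C m
prime∣pCk {p@(suc p′)} {m} pr 0<m m<p
  with euclidsLemma (p C m) _ pr (subst (p ℕᵈ.∣_) (sym (nCm*m!*[n∸m]!≡n! (ℕₚ.<⇒≤ m<p))) (ℕᵈ.m∣m*n (p′ !)))
... | inj₁ p∣pCm = p∣pCm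
... | inj₂ p∣m!*[p∸m]! with euclidsLemma (m !) ((p ∸ m) !) pr p∣m!*[p∸m]!
...   | inj₁ p∣m!     = contradiction (p∣n!⇒p≤n pr p∣m!) (ℕₚ.<⇒≱ m<p)
...   | inj₂ p∣[p∸m]! = contradiction (p∣n!⇒p≤n pr p∣[p∸m]!) (ℕₚ.<⇒≱ (ℕₚ.∸-monoʳ-< {o = 0} 0<m (ℕₚ.<⇒≤ m<p)))

euclidsLemmaℤ : Prime p → + p ∣ x * y → + p ∣ x ⊎ + p ∣ y
euclidsLemmaℤ {x = x} {y} pr p∣xy
  with euclidsLemma ℤ.∣ x ∣ ℤ.∣ y ∣ pr (subst (_ ℕᵈ.∣_) (ℤₚ.abs-* x y) (∣⇒∣ᵤ p∣xy))
... | inj₁ p∣x = inj₁ (∣ᵤ⇒∣ p∣x)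
... | inj₂ p∣y = inj₂ (∣ᵤ⇒∣ p∣y)

prime∤^ : Prime p → ¬ + p ∣ x → ¬ + p ∣ x ^ e
prime∤^ {e = zero} pr _ p∣1 = ℕ.nonTrivial⇒≢1 {{prime⇒nonTrivial pr}} (ℕᵈ.∣1⇒≡1 (∣⇒∣ᵤ p∣1))
prime∤^ {e = suc e} pr p∤x p∣x^1+e with euclidsLemmaℤ pr p∣x^1+e
... | inj₁ p∣x   = p∤x p∣x
... | inj₂ p∣x^e = prime∤^ {e = e} pr p∤x p∣x^e

-- Fermat's little theorem

×≡* : ∀ n x → n Raw.× x ≡ + n * x
×≡* zero    x = refl
×≡* (suc n) x = begin
  x + n Raw.× x      ≡⟨ cong (_+_ x) (×≡* n x) ⟩
  x + + n * x        ≡⟨ cong (_+ + n * x) (ℤₚ.*-identityˡ x) ⟨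
  1ℤ * x + + n * x   ≡⟨ ℤₚ.*-distribʳ-+ x 1ℤ (+ n) ⟨
  + suc n * x        ∎
  where open ≡-Reasoning

^≡^ : ∀ x n → x Raw.^ n ≡ x ^ n
^≡^ x zero    = refl
^≡^ x (suc n) = cong (x *_) (^≡^ x n)

∣-sum : ∀ {d n} (f : Fin n → ℤ) → (∀ i → d ∣ f i) → d ∣ Sum.sum f
∣-sum {n = zero}  f d∣f = divides 0ℤ refl
∣-sum {n = suc n} f d∣f = ∣m∣n⇒∣m+n (d∣f Fin.zero) (∣-sum (λ i → f (Fin.suc i)) (λ i → d∣f (Fin.suc i)))

binomialTerm[x,1]≡ : ∀ x n k → Binomial.binomialTerm x 1ℤ n k ≡ + (n C toℕ k) * x ^ toℕ k
binomialTerm[x,1]≡ x n k = begin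
  (n C j) Raw.× (x Raw.^ j * 1ℤ Raw.^ (n ∸ j)) ≡⟨ ×≡* (n C j) _ ⟩
  + (n C j) * (x Raw.^ j * 1ℤ Raw.^ (n ∸ j))
    ≡⟨ cong₂ (λ u v → + (n C j) * (u * v)) (^≡^ x j) (trans (^≡^ 1ℤ (n ∸ j)) (ℤₚ.^-zeroˡ (n ∸ j))) ⟩
  + (n C j) * (x ^ j * 1ℤ)                     ≡⟨ cong (+ (n C j) *_) (ℤₚ.*-identityʳ (x ^ j)) ⟩
  + (n C j) * x ^ j                            ∎
  where
  open ≡-Reasoning
  j : ℕ
  j = toℕ k

prime∣[x+1]^p-x^p-1 : Prime p → + p ∣ (x + 1ℤ) ^ p - x ^ p - 1ℤ
prime∣[x+1]^p-x^p-1 {p@(suc p′)} {x} pr = subst (+ p ∣_) (sym expansion) (∣-sum middle p∣middle)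
  where
  open ≡-Reasoning
  term : Fin (suc p) → ℤ
  term = Binomial.binomialTerm x 1ℤ p
  middle : Fin p′ → ℤ
  middle i = term (Fin.suc (inject₁ i))

  first : term Fin.zero ≡ 1ℤ
  first = binomialTerm[x,1]≡ x p Fin.zero

  last : term (fromℕ p) ≡ x ^ p
  last = begin
    term (fromℕ p)                         ≡⟨ binomialTerm[x,1]≡ x p (fromℕ p) ⟩
    + (p C toℕ (fromℕ p)) * x ^ toℕ (fromℕ p) ≡⟨ cong (λ j → + (p C j) * x ^ j) (Finₚ.toℕ-fromℕ p) ⟩
    + (p C p) * x ^ p                       ≡⟨ cong (λ c → + c * x ^ p) (nCn≡1 p) ⟩
    1ℤ * x ^ p                              ≡⟨ ℤₚ.*-identityˡ (x ^ p) ⟩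
    x ^ p                                   ∎

  cancel : ∀ S X → (1ℤ + (S + X)) - X - 1ℤ ≡ S
  cancel = solve-∀

  expansion : (x + 1ℤ) ^ p - x ^ p - 1ℤ ≡ Sum.sum middle
  expansion = begin
    (x + 1ℤ) ^ p - x ^ p - 1ℤ
      ≡⟨ cong (λ z → z - x ^ p - 1ℤ) (^≡^ (x + 1ℤ) p) ⟨
    (x + 1ℤ) Raw.^ p - x ^ p - 1ℤ
      ≡⟨ cong (λ z → z - x ^ p - 1ℤ) (Binomial.theorem p x 1ℤ) ⟩
    term Fin.zero + Sum.sum (λ i → term (Fin.suc i)) - x ^ p - 1ℤ
      ≡⟨ cong (λ z → term Fin.zero + z - x ^ p - 1ℤ) (Sum.sum-init-last (λ i → term (Fin.suc i))) ⟩
    term Fin.zero + (Sum.sum middle + term (fromℕ p)) - x ^ p - 1ℤ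
      ≡⟨ cong₂ (λ u v → u + (Sum.sum middle + v) - x ^ p - 1ℤ) first last ⟩
    1ℤ + (Sum.sum middle + x ^ p) - x ^ p - 1ℤ
      ≡⟨ cancel (Sum.sum middle) (x ^ p) ⟩
    Sum.sum middle ∎

  p∣middle : ∀ i → + p ∣ middle i
  p∣middle i = subst (+ p ∣_) (sym (binomialTerm[x,1]≡ x p k))
    (∣m⇒∣m*n {m = + (p C toℕ k)} (x ^ toℕ k) (∣ᵤ⇒∣ (prime∣pCk pr (s≤s z≤n) (s≤s (Finₚ.inject₁ℕ< i)))))
    where
    k : Fin (suc p)
    k = Fin.suc (inject₁ i)

fermat : Prime p → ∀ a → + p ∣ (+ a) ^ p - + a
fermat {suc p′} pr zero    = divides 0ℤ refl
fermat {p}      pr (suc a) = subst (λ z → + p ∣ z ^ p - z) (ℤₚ.+-comm (+ a) 1ℤ)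
  (subst (+ p ∣_) (sym (split ((+ a + 1ℤ) ^ p) ((+ a) ^ p) (+ a)))
    (∣m∣n⇒∣m+n (prime∣[x+1]^p-x^p-1 pr) (fermat pr a)))
  where
  split : ∀ P Q X → P - (X + 1ℤ) ≡ (P - Q - 1ℤ) + (Q - X)
  split = solve-∀

-- Finite differences

Δ : (ℤ → ℤ) → ℤ → ℤ
Δ f x = f (1ℤ + x) - f x

Δ^ : ℕ → (ℤ → ℤ) → ℤ → ℤ
Δ^ zero    f = f
Δ^ (suc n) f = Δ (Δ^ n f)

Δ^-leibniz : ∀ f n x → Δ^ (suc n) (λ y → y * f y) x ≡ x * Δ^ (suc n) f x + + suc n * Δ^ n f (1ℤ + x)
Δ^-leibniz f zero    x = base x (f (1ℤ + x)) (f x)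
  where
  base : ∀ x a b → (1ℤ + x) * a - x * b ≡ x * (a - b) + 1ℤ * a
  base = solve-∀
Δ^-leibniz f (suc n) x =
  trans (cong₂ _-_ (Δ^-leibniz f n (1ℤ + x)) (Δ^-leibniz f n x))
        (step x (+ suc n) (Δ^ n f (1ℤ + (1ℤ + x))) (Δ^ n f (1ℤ + x)) (Δ^ (suc n) f x))
  where
  step : ∀ x m c d e →
    (1ℤ + x) * (c - d) + m * c - (x * e + m * d) ≡ x * ((c - d) - e) + (1ℤ + m) * (c - d)
  step = solve-∀

Δ^n[y^n]≡n! : ∀ n x → Δ^ n (_^ n) x ≡ + (n !)
Δ^n[y^n]≡n! zero    x = refl
Δ^n[y^n]≡n! (suc n) x = begin
  Δ^ (suc n) (λ y → y * y ^ n) x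
    ≡⟨ Δ^-leibniz (_^ n) n x ⟩
  x * (Δ^ n (_^ n) (1ℤ + x) - Δ^ n (_^ n) x) + + suc n * Δ^ n (_^ n) (1ℤ + x)
    ≡⟨ cong₂ (λ u v → x * (u - v) + + suc n * u) (Δ^n[y^n]≡n! n (1ℤ + x)) (Δ^n[y^n]≡n! n x) ⟩
  x * (+ (n !) - + (n !)) + + suc n * + (n !)
    ≡⟨ vanish x (+ (n !)) (+ suc n) ⟩
  + suc n * + (n !)
    ≡⟨ ℤₚ.pos-* (suc n) (n !) ⟨
  + (suc n !) ∎
  where
  open ≡-Reasoning
  vanish : ∀ x c m → x * (c - c) + m * c ≡ m * c
  vanish = solve-∀

Δ^suc[f-c]≡Δ^suc[f] : ∀ f c n x → Δ^ (suc n) (λ y → f y - c) x ≡ Δ^ (suc n) f x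
Δ^suc[f-c]≡Δ^suc[f] f c zero    x = cancel (f (1ℤ + x)) (f x) c
  where
  cancel : ∀ a b c → (a - c) - (b - c) ≡ a - b
  cancel = solve-∀
Δ^suc[f-c]≡Δ^suc[f] f c (suc n) x =
  cong₂ _-_ (Δ^suc[f-c]≡Δ^suc[f] f c n (1ℤ + x)) (Δ^suc[f-c]≡Δ^suc[f] f c n x)

∣Δ^ : ∀ {d f} n i → (∀ k → k ℕ.≤ n → d ∣ f (+ (i ℕ.+ k))) → d ∣ Δ^ n f (+ i)
∣Δ^ {d} {f} zero i d∣f = subst (λ j → d ∣ f (+ j)) (ℕₚ.+-identityʳ i) (d∣f 0 z≤n)
∣Δ^ {d} {f} (suc n) i d∣f = ∣m∣n⇒∣m-n
  (∣Δ^ n (suc i) (λ k k≤n → subst (λ j → d ∣ f (+ j)) (ℕₚ.+-suc i k) (d∣f (suc k) (s≤s k≤n))))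
  (∣Δ^ n i (λ k k≤n → d∣f k (ℕₚ.m≤n⇒m≤1+n k≤n)))

-- Exponents of the unit group modulo a prime

ExponentOfUnits : ℕ → ℕ → Set
ExponentOfUnits p e = ∀ a → 0 ℕ.< a → a ℕ.< p → + p ∣ (+ a) ^ e - 1ℤ

unit∤ : 0 ℕ.< a → a ℕ.< p → ¬ + p ∣ + a
unit∤ {suc a} _ a<p p∣a = ℕₚ.<⇒≱ a<p (ℕᵈ.∣⇒≤ (∣⇒∣ᵤ p∣a))

cancel-unit^ : Prime p → 0 ℕ.< a → a ℕ.< p → + p ∣ (+ a) ^ e * x → + p ∣ x
cancel-unit^ {a = a} {e = e} pr 0<a a<p p∣a^e*x with euclidsLemmaℤ {x = (+ a) ^ e} pr p∣a^e*x
... | inj₁ p∣a^e = contradiction p∣a^e (prime∤^ {e = e} pr (unit∤ 0<a a<p))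
... | inj₂ p∣x   = p∣x

exponentOfUnits-+ : ExponentOfUnits p e → ExponentOfUnits p g → ExponentOfUnits p (e ℕ.+ g)
exponentOfUnits-+ {p} {e} {g} ue ug a 0<a a<p =
  subst (λ z → + p ∣ z - 1ℤ) (sym (ℤₚ.^-distribˡ-+-* (+ a) e g))
    (subst (+ p ∣_) (sym (split ((+ a) ^ e) ((+ a) ^ g)))
      (∣m∣n⇒∣m+n (∣n⇒∣m*n ((+ a) ^ e) (ug a 0<a a<p)) (ue a 0<a a<p)))
  where
  split : ∀ A B → A * B - 1ℤ ≡ A * (B - 1ℤ) + (A - 1ℤ)
  split = solve-∀

exponentOfUnits-* : ExponentOfUnits p e → ∀ j → ExponentOfUnits p (j ℕ.* e)
exponentOfUnits-* ue zero    _ _ _ = divides 0ℤ refl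
exponentOfUnits-* {e = e} ue (suc j) = exponentOfUnits-+ {e = e} {g = j ℕ.* e} ue (exponentOfUnits-* ue j)

exponentOfUnits-∸ : Prime p → ExponentOfUnits p (e ℕ.+ g) → ExponentOfUnits p g → ExponentOfUnits p e
exponentOfUnits-∸ {p} {e} {g} pr ue+g ug a 0<a a<p = cancel-unit^ {e = g} pr 0<a a<p
  (subst (+ p ∣_) (split ((+ a) ^ e) ((+ a) ^ g))
    (∣m∣n⇒∣m-n (subst (λ z → + p ∣ z - 1ℤ) (ℤₚ.^-distribˡ-+-* (+ a) e g) (ue+g a 0<a a<p)) (ug a 0<a a<p)))
  where
  split : ∀ A B → (A * B - 1ℤ) - (B - 1ℤ) ≡ B * (A - 1ℤ)
  split = solve-∀

power-sub⇒exponentOfUnits : Prime p → (∀ a → + p ∣ (+ a) ^ suc e - + a) → ExponentOfUnits p e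
power-sub⇒exponentOfUnits {p} {e} pr h a 0<a a<p =
  cancel-unit^ {e = 1} pr 0<a a<p (subst (+ p ∣_) (factor (+ a) ((+ a) ^ e)) (h a))
  where
  factor : ∀ a A → a * A - a ≡ (a * 1ℤ) * (A - 1ℤ)
  factor = solve-∀

fermat-exponentOfUnits : Prime p → ExponentOfUnits p (p ∸ 1)
fermat-exponentOfUnits {suc p′} pr = power-sub⇒exponentOfUnits {e = p′} pr (fermat pr)

exponentOfUnits-<⇒≡0 : Prime p → ExponentOfUnits p g → g ℕ.< p ∸ 1 → g ≡ 0
exponentOfUnits-<⇒≡0 {g = zero}  pr ug g<p-1 = refl
exponentOfUnits-<⇒≡0 {suc p′} {suc g} pr ug 1+g<p′ =
  contradiction (p∣n!⇒p≤n pr p∣[1+g]!) (ℕₚ.<⇒≱ (ℕₚ.m<n⇒m<1+n 1+g<p′))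
  where
  f : ℤ → ℤ
  f y = y ^ suc g - 1ℤ
  p∣Δf : + suc p′ ∣ Δ^ (suc g) f 1ℤ
  p∣Δf = ∣Δ^ (suc g) 1 λ k k≤1+g → ug (suc k) (s≤s z≤n) (s≤s (ℕₚ.≤-<-trans k≤1+g 1+g<p′))
  p∣[1+g]! : suc p′ ℕᵈ.∣ suc g !
  p∣[1+g]! = ∣⇒∣ᵤ (subst (+ suc p′ ∣_) Δf≡[1+g]! p∣Δf)
    where
    Δf≡[1+g]! : Δ^ (suc g) f 1ℤ ≡ + (suc g !)
    Δf≡[1+g]! = trans (Δ^suc[f-c]≡Δ^suc[f] (_^ suc g) 1ℤ g 1ℤ) (Δ^n[y^n]≡n! (suc g) 1ℤ)

exponentOfUnits⇒p-1∣ : Prime p → ExponentOfUnits p e → (p ∸ 1) ℕᵈ.∣ e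
exponentOfUnits⇒p-1∣ {p@(suc d@(suc _))} {e} pr ue =
  ℕᵈ.m%n≡0⇒n∣m e d (exponentOfUnits-<⇒≡0 pr u[e%d] (m%n<n e d))
  where
  u[e%d] : ExponentOfUnits p (e % d)
  u[e%d] = exponentOfUnits-∸ {e = e % d} {g = (e / d) ℕ.* d} pr
    (subst (ExponentOfUnits p) (m≡m%n+[m/n]*n e d) ue)
    (exponentOfUnits-* (fermat-exponentOfUnits pr) (e / d))

korselt : Prime p → (∀ x → + p ∣ x ^ suc m - x) → + p - 1ℤ ∣ + m
korselt {suc p′} {m} pr h =
  ∣ᵤ⇒∣ (exponentOfUnits⇒p-1∣ pr (power-sub⇒exponentOfUnits {e = m} pr (λ a → h (+ a))))

∣x*y-z⇒∣x-z : ∀ {d} → d ∣ x * y - K → d ∣ y - 1ℤ → d ∣ x - K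
∣x*y-z⇒∣x-z {x} {y} {K} d∣xy-K d∣y-1 =
  subst (_ ∣_) (regroup x y K) (∣m∣n⇒∣m-n d∣xy-K (∣n⇒∣m*n x d∣y-1))
  where
  regroup : ∀ x y K → (x * y - K) - x * (y - 1ℤ) ≡ x - K
  regroup = solve-∀

InC⇒[q-1]∣n-K : InC K n → Prime q → q ℕᵈ.∣ n → + q - 1ℤ ∣ + n - K
InC⇒[q-1]∣n-K {n = n} {q = q} (K<n , _ , n∣x^[n-K+1]-x) qr q∣n =
  subst (_ ∣_) (ℤₚ.0≤i⇒+∣i∣≡i (ℤₚ.i≤j⇒0≤j-i (ℤₚ.<⇒≤ K<n)))
    (korselt qr (λ x → ∣-trans (∣ᵤ⇒∣ {+ q} {+ n} q∣n) (∣ᵤ⇒∣ (n∣x^[n-K+1]-x x))))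

InC⇒[q-1]∣m-K : InC K (m ℕ.* q) → Prime q → + q - 1ℤ ∣ + m - K
InC⇒[q-1]∣m-K {K} {m} {q} inC qr =
  ∣x*y-z⇒∣x-z {x = + m} {y = + q} {K = K}
    (subst (λ z → + q - 1ℤ ∣ z - K) (ℤₚ.pos-* m q) (InC⇒[q-1]∣n-K inC qr (ℕᵈ.n∣m*n m))) ∣-refl

-- Bounding the two primes

quotientBound : ℕ → ℕ → ℕ
quotientBound l A = l ℕ.+ l ℕ.+ A

smallPrimeBound : ℕ → ℕ → ℕ
smallPrimeBound l A = suc ((l ℕ.+ A) ℕ.* (l ℕ.+ quotientBound l A))

primeBound : ℕ → ℕ → ℕ
primeBound l A = l ℕ.* smallPrimeBound l A ℕ.+ suc A

∣l*p-K∣≤l*p+∣K∣ : ∀ l p K → ℤ.∣ + l * + p - K ∣ ℕ.≤ l ℕ.* p ℕ.+ ℤ.∣ K ∣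
∣l*p-K∣≤l*p+∣K∣ l p K =
  subst (λ z → ℤ.∣ + l * + p - K ∣ ℕ.≤ z ℕ.+ ℤ.∣ K ∣) (ℤₚ.abs-* (+ l) (+ p)) (ℤₚ.∣i-j∣≤∣i∣+∣j∣ (+ l * + p) K)

+∣⇒≤∣∣ : ∀ {d} → x ≢ 0ℤ → + d ∣ x → d ℕ.≤ ℤ.∣ x ∣
+∣⇒≤∣∣ x≢0 d∣x = ℕᵈ.∣⇒≤ {{ℕ.≢-nonZero (x≢0 ∘ ℤₚ.∣i∣≡0⇒i≡0)}} (∣⇒∣ᵤ d∣x)

quotient-bound : .{{NonZero Q}} → p ℕ.≤ suc Q → + l * + p - K ≡ t * + Q → ℤ.∣ t ∣ ℕ.≤ quotientBound l ℤ.∣ K ∣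
quotient-bound {Q = Q} {p = p} {l = l} {K = K} {t = t} p≤1+Q eq =
  ℕₚ.*-cancelʳ-≤ ℤ.∣ t ∣ (quotientBound l A) Q (begin
    ℤ.∣ t ∣ ℕ.* Q                      ≡⟨ ℤₚ.abs-* t (+ Q) ⟨
    ℤ.∣ t * + Q ∣                       ≡⟨ cong ℤ.∣_∣ eq ⟨
    ℤ.∣ + l * + p - K ∣                 ≤⟨ ∣l*p-K∣≤l*p+∣K∣ l p K ⟩
    l ℕ.* p ℕ.+ A                      ≤⟨ ℕₚ.+-monoˡ-≤ A (ℕₚ.*-monoʳ-≤ l p≤1+Q) ⟩
    l ℕ.* suc Q ℕ.+ A                  ≡⟨ unfold l Q A ⟩
    l ℕ.* Q ℕ.+ (l ℕ.+ A)              ≤⟨ ℕₚ.+-monoʳ-≤ (l ℕ.* Q) (ℕₚ.+-mono-≤ (ℕₚ.m≤m*n l Q) (ℕₚ.m≤m*n A Q)) ⟩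
    l ℕ.* Q ℕ.+ (l ℕ.* Q ℕ.+ A ℕ.* Q)  ≡⟨ collect l Q A ⟩
    quotientBound l A ℕ.* Q            ∎)
  where
  open ℕₚ.≤-Reasoning
  A : ℕ
  A = ℤ.∣ K ∣
  unfold : ∀ l Q A → l ℕ.* suc Q ℕ.+ A ≡ l ℕ.* Q ℕ.+ (l ℕ.+ A)
  unfold = ℕ-Solver.solve-∀
  collect : ∀ l Q A → l ℕ.* Q ℕ.+ (l ℕ.* Q ℕ.+ A ℕ.* Q) ≡ (l ℕ.+ l ℕ.+ A) ℕ.* Q
  collect = ℕ-Solver.solve-∀

l+t≡0⇒K≡l[p+Q] : + l * + p - K ≡ t * + Q → + l + t ≡ 0ℤ → K ≡ + (l ℕ.* (p ℕ.+ Q))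
l+t≡0⇒K≡l[p+Q] {l} {p} {K} {t} {Q} eq l+t≡0 = begin
  K                                                 ≡⟨ expand (+ l) (+ p) K t (+ Q) ⟩
  + l * (+ p + + Q) - ((+ l * + p - K) - t * + Q) - (+ l + t) * + Q
    ≡⟨ cong₂ (λ u v → + l * (+ p + + Q) - (u - t * + Q) - v * + Q) eq l+t≡0 ⟩
  + l * (+ p + + Q) - (t * + Q - t * + Q) - 0ℤ * + Q  ≡⟨ vanish (+ l * (+ p + + Q)) (t * + Q) (+ Q) ⟩
  + l * (+ p + + Q)                                 ≡⟨ ℤₚ.pos-* l (p ℕ.+ Q) ⟨
  + (l ℕ.* (p ℕ.+ Q))                               ∎
  where
  open ≡-Reasoning
  expand : ∀ L P K t Q → K ≡ L * (P + Q) - ((L * P - K) - t * Q) - (L + t) * Q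
  expand = solve-∀
  vanish : ∀ a b c → a - (b - b) - 0ℤ * c ≡ a
  vanish = solve-∀

P∣[l-K][l+t] : + P ∣ + l * + suc Q - K → + l * + suc P - K ≡ t * + Q → + P ∣ (+ l - K) * (+ l + t)
P∣[l-K][l+t] {P} {l} {Q} {K} {t} P∣lq-K eq = subst (+ P ∣_) (sym (regroup (+ l) K t (+ P) (+ Q)))
  (∣m∣n⇒∣m+n (∣m∣n⇒∣m-n (∣n⇒∣m*n t P∣lq-K) (∣n⇒∣m*n (+ l * + l) ∣-refl))
             (∣n⇒∣m*n (+ l) (subst (+ P ∣_) (sym lp-K-tQ≡0) (divides 0ℤ refl))))
  where
  regroup : ∀ L K t P Q →
    (L - K) * (L + t) ≡ t * (L * (1ℤ + Q) - K) - L * L * P + L * ((L * (1ℤ + P) - K) - t * Q)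
  regroup = solve-∀
  lp-K-tQ≡0 : (+ l * + suc P - K) - t * + Q ≡ 0ℤ
  lp-K-tQ≡0 = trans (cong (_- t * + Q) eq) (ℤₚ.+-inverseʳ (t * + Q))

small-prime-bound : + P ∣ (+ l - K) * (+ l + t) → + l ≢ K → + l + t ≢ 0ℤ →
                    ℤ.∣ t ∣ ℕ.≤ quotientBound l ℤ.∣ K ∣ → suc P ℕ.≤ smallPrimeBound l ℤ.∣ K ∣
small-prime-bound {P} {l} {K} {t} P∣ l≢K l+t≢0 ∣t∣≤ = s≤s (begin
  P                                  ≤⟨ +∣⇒≤∣∣ product≢0 P∣ ⟩
  ℤ.∣ (+ l - K) * (+ l + t) ∣         ≡⟨ ℤₚ.abs-* (+ l - K) (+ l + t) ⟩
  ℤ.∣ + l - K ∣ ℕ.* ℤ.∣ + l + t ∣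
    ≤⟨ ℕₚ.*-mono-≤ (ℤₚ.∣i-j∣≤∣i∣+∣j∣ (+ l) K) (ℕₚ.≤-trans (ℤₚ.∣i+j∣≤∣i∣+∣j∣ (+ l) t) (ℕₚ.+-monoʳ-≤ l ∣t∣≤)) ⟩
  (l ℕ.+ ℤ.∣ K ∣) ℕ.* (l ℕ.+ quotientBound l ℤ.∣ K ∣) ∎)
  where
  open ℕₚ.≤-Reasoning
  product≢0 : (+ l - K) * (+ l + t) ≢ 0ℤ
  product≢0 product≡0 with ℤₚ.i*j≡0⇒i≡0∨j≡0 (+ l - K) product≡0
  ... | inj₁ l-K≡0 = l≢K (ℤₚ.i-j≡0⇒i≡j (+ l) K l-K≡0)
  ... | inj₂ l+t≡0 = l+t≢0 l+t≡0

large-prime-bound : .{{NonZero ℤ.∣ t ∣}} → + l * + p - K ≡ t * + Q → p ℕ.≤ smallPrimeBound l ℤ.∣ K ∣ →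
                    suc Q ℕ.≤ primeBound l ℤ.∣ K ∣
large-prime-bound {t = t} {l = l} {p = p} {K = K} {Q = Q} eq p≤ = begin
  suc Q                                     ≤⟨ s≤s (ℕₚ.m≤n*m Q ℤ.∣ t ∣) ⟩
  suc (ℤ.∣ t ∣ ℕ.* Q)                        ≡⟨ cong suc (trans (cong ℤ.∣_∣ eq) (ℤₚ.abs-* t (+ Q))) ⟨
  suc ℤ.∣ + l * + p - K ∣                    ≤⟨ s≤s (∣l*p-K∣≤l*p+∣K∣ l p K) ⟩
  suc (l ℕ.* p ℕ.+ ℤ.∣ K ∣)                  ≤⟨ s≤s (ℕₚ.+-monoˡ-≤ ℤ.∣ K ∣ (ℕₚ.*-monoʳ-≤ l p≤)) ⟩
  suc (l ℕ.* smallPrimeBound l ℤ.∣ K ∣ ℕ.+ ℤ.∣ K ∣) ≡⟨ ℕₚ.+-suc _ ℤ.∣ K ∣ ⟨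
  primeBound l ℤ.∣ K ∣                       ∎
  where open ℕₚ.≤-Reasoning

A≤primeBound : ∀ l A → A ℕ.≤ primeBound l A
A≤primeBound l A = ℕₚ.≤-trans (ℕₚ.n≤1+n A) (ℕₚ.m≤n+m (suc A) (l ℕ.* smallPrimeBound l A))

smallPrimeBound≤primeBound : 1 ℕ.≤ l → ∀ A → smallPrimeBound l A ℕ.≤ primeBound l A
smallPrimeBound≤primeBound {l} 1≤l A =
  ℕₚ.≤-trans (ℕₚ.m≤n*m (smallPrimeBound l A) l {{ℕ.>-nonZero 1≤l}}) (ℕₚ.m≤m+n _ (suc A))

cross-divisible⇒bounded-≤ : 1 ℕ.≤ l → 2 ℕ.≤ p → p ℕ.≤ q →
  + q - 1ℤ ∣ + l * + p - K → + p - 1ℤ ∣ + l * + q - K → + l ≢ K → + l * + p ≢ K →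
  p ℕ.≤ primeBound l ℤ.∣ K ∣ × q ℕ.≤ primeBound l ℤ.∣ K ∣
-- Here + suc Q - 1ℤ reduces to + Q, so the quotient t of q − 1 ∣ lp − K comes with lp − K ≡ t (q − 1).
cross-divisible⇒bounded-≤ {l} {suc P} {suc Q} {K} 1≤l (s≤s 1≤P) p≤q (divides t eq) P∣lq-K l≢K lp≢K
  with + l + t ℤₚ.≟ 0ℤ
... | yes l+t≡0 = ℕₚ.≤-trans (ℕₚ.m≤m+n (suc P) Q) p+Q≤B , ℕₚ.≤-trans (ℕₚ.+-monoˡ-≤ Q (s≤s z≤n)) p+Q≤B
  where
  open ℕₚ.≤-Reasoning
  instance
    _ : NonZero l
    _ = ℕ.>-nonZero 1≤l
  p+Q≤B : suc P ℕ.+ Q ℕ.≤ primeBound l ℤ.∣ K ∣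
  p+Q≤B = begin
    suc P ℕ.+ Q           ≤⟨ ℕₚ.m≤n*m (suc P ℕ.+ Q) l ⟩
    l ℕ.* (suc P ℕ.+ Q)   ≡⟨ cong ℤ.∣_∣ (l+t≡0⇒K≡l[p+Q] {l = l} {K = K} {t = t} {Q = Q} eq l+t≡0) ⟨
    ℤ.∣ K ∣                ≤⟨ A≤primeBound l ℤ.∣ K ∣ ⟩
    primeBound l ℤ.∣ K ∣   ∎
... | no l+t≢0 =
  ℕₚ.≤-trans p≤ (smallPrimeBound≤primeBound 1≤l ℤ.∣ K ∣) , large-prime-bound {t = t} {l = l} {K = K} eq p≤
  where
  t≢0 : t ≢ 0ℤ
  t≢0 refl = lp≢K (ℤₚ.i-j≡0⇒i≡j (+ l * + suc P) K eq)
  instance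
    _ : NonZero Q
    _ = ℕ.>-nonZero (ℕₚ.≤-trans 1≤P (ℕₚ.≤-pred p≤q))
    _ : NonZero ℤ.∣ t ∣
    _ = ℕ.≢-nonZero (t≢0 ∘ ℤₚ.∣i∣≡0⇒i≡0)
  ∣t∣≤ : ℤ.∣ t ∣ ℕ.≤ quotientBound l ℤ.∣ K ∣
  ∣t∣≤ = quotient-bound {l = l} {K = K} {t = t} p≤q eq
  P∣ : + P ∣ (+ l - K) * (+ l + t)
  P∣ = P∣[l-K][l+t] {l = l} {Q = Q} {K = K} {t = t} P∣lq-K eq
  p≤ : suc P ℕ.≤ smallPrimeBound l ℤ.∣ K ∣
  p≤ = small-prime-bound {t = t} P∣ l≢K l+t≢0 ∣t∣≤

cross-divisible⇒bounded : 1 ℕ.≤ l → 2 ℕ.≤ p → 2 ℕ.≤ q →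
  + q - 1ℤ ∣ + (l ℕ.* p) - K → + p - 1ℤ ∣ + (l ℕ.* q) - K →
  + l ≢ K → + (l ℕ.* p) ≢ K → + (l ℕ.* q) ≢ K →
  p ℕ.≤ primeBound l ℤ.∣ K ∣ × q ℕ.≤ primeBound l ℤ.∣ K ∣
cross-divisible⇒bounded {l} {p} {q} {K} 1≤l 2≤p 2≤q q-1∣ p-1∣ l≢K lp≢K lq≢K =
  [ (λ p≤q → cross-divisible⇒bounded-≤ 1≤l 2≤p p≤q (toℤ q-1∣) (toℤ p-1∣) l≢K (lp≢K ∘ trans (ℤₚ.pos-* l p)))
  , (λ q≤p → swap (cross-divisible⇒bounded-≤ 1≤l 2≤q q≤p (toℤ p-1∣) (toℤ q-1∣) l≢K (lq≢K ∘ trans (ℤₚ.pos-* l q))))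
  ]′ (ℕₚ.≤-total p q)
  where
  toℤ : ∀ {d m} → d ∣ + (l ℕ.* m) - K → d ∣ + l * + m - K
  toℤ {d} {m} = subst (λ z → d ∣ z - K) (ℤₚ.pos-* l m)

proposition5p2 : (k : ℤ) (l : ℕ) → l ℕ.> 0 →
    ∃ λ B → (p q : ℕ) → Prime p → Prime q →
      InC k (l ℕ.* p ℕ.* q) →
      + l ≢ k → + (l ℕ.* p) ≢ k → + (l ℕ.* q) ≢ k →
      p ℕ.≤ B × q ℕ.≤ B
proposition5p2 k l l>0 = primeBound l ℤ.∣ k ∣ , λ p q pr qr inC →
  cross-divisible⇒bounded l>0 (prime⇒2≤ pr) (prime⇒2≤ qr)
    (InC⇒[q-1]∣m-K inC qr) (InC⇒[q-1]∣m-K (subst (InC k) (swap-last l p q) inC) pr)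
  where
  swap-last : ∀ l p q → l ℕ.* p ℕ.* q ≡ l ℕ.* q ℕ.* p
  swap-last = ℕ-Solver.solve-∀
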